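{- Let $\sigma$ be a $\lambda^{hs}$ type and $\theta$ a finite map from labels to $\lambda^{hs}$ terms such that $\theta(\psi)\in\mathrm{Red}_{\mathcal T^\sigma(\psi)}$ for every $\psi\in\mathrm{dom}(\theta)$. Then $\mathsf{TI}(\theta)\in\mathrm{Red}_\sigma$.
   Context: The calculus $\lambda^{hs}$. Simple variables $a$ and audited variables $u$ are disjoint. Labels $\psi\in\{\mathsf{refl},\mathsf{trans},\beta,\beta_\Box,\mathsf{ti},\mathsf{lam},\mathsf{app},\mathsf{let},\mathsf{trpl}_{[]},\mathsf{trpl}_{::},\mathsf{d}\}$. Types $\tau,\sigma ::= P\mid\tau\supset\sigma\mid\Box\tau$; terms $s,t ::= a\mid u\mid\lambda a^\tau.s\mid s\,t\mid\,!s\mid\mathsf{let}(u^\tau:=s,t)\mid\mathsf{TI}(\theta)$, $\theta$ a finite map from labels to terms. Trails $q ::= \mathsf{refl}(s)\mid\mathsf{trans}(q,q')\mid\beta(a^\tau.s,t)\mid\beta_\Box(s,u^\tau.t)\mid\mathsf{ti}(q,\theta)\mid\mathsf{lam}(a^\tau.q)\mid\mathsf{app}(q,q')\mid\mathsf{let}(q,u^\tau.q')\mid\mathsf{trpl}(\zeta)$ ($\zeta$ finite ordered map labels$\to$trails). $q\theta$: if the head label of $q$ ($\mathsf{trpl}_{[]}$/$\mathsf{trpl}_{::}$ for $\mathsf{trpl}(\zeta)$ with $\zeta$ empty/nonempty) is not in $\mathrm{dom}(\theta)$ then $\theta(\mathsf{d})$; otherwise $\mathsf{refl},\beta,\beta_\Box,\mathsf{ti}$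 give $\theta$ of their label, $\mathsf{trans}(q_1,q_2)\theta=\theta(\mathsf{trans})(q_1\theta)(q_2\theta)$ and likewise $\mathsf{app},\mathsf{let}$, $\mathsf{lam}(a^\tau.q_1)\theta=\theta(\mathsf{lam})(q_1\theta)$, $\mathsf{trpl}(\{\})\theta=\theta(\mathsf{trpl}_{[]})$, $\mathsf{trpl}(\{q_1/\psi_1,\vec{q'/\psi'}\})\theta=\theta(\mathsf{trpl}_{::})(q_1\theta)(\mathsf{trpl}(\{\vec{q'/\psi'}\})\theta)$. $\mathcal T^\sigma(\psi)=\sigma$ for $\psi\in\{\mathsf{d},\mathsf{refl},\beta,\beta_\Box,\mathsf{ti},\mathsf{trpl}_{[]}\}$, $\sigma\supset\sigma$ for $\mathsf{lam}$, $\sigma\supset\sigma\supset\sigma$ for $\mathsf{trans},\mathsf{app},\mathsf{let},\mathsf{trpl}_{::}$. $s[t/a]$ is capture-avoiding and does not enter $!$; $s[t/u]$ is capture-avoiding and enters $!$. Reduction $\to$: closure under all contexts (including under $\lambda$, $!$, both arguments of $\mathsf{let}$ and any branch of $\mathsf{TI}$) of $(\lambda a^\tau.s)\,t\to s[t/a]$, $\mathsf{let}(u^\tau:=\,!s,t)\to t[s/u]$, $\mathsf{TI}(\theta)\to q\theta$ for any trail $q$ (for which $q\theta$ is defined). $\mathrm{SN}$: strongly normalizing terms. Neutral: not of the form $\lambda a^\tau.s$ or $!s$. $\mathcal C\in\mathrm{CR}$ iff (CR1) $\mathcal C\subseteq\mathrm{SN}$; (CR2) closed under $\to$; (CR3)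 a neutral term all of whose one-step reducts are in $\mathcal C$ is in $\mathcal C$. $\mathcal C^u_{\mathcal D}=\{s\in\mathcal C:\forall t\in\mathcal D,\ s[t/u]\in\mathcal C\}$. $\mathrm{Red}_P=\mathrm{SN}$; $\mathrm{Red}_{\tau\supset\sigma}=\{s:\forall t\in\mathrm{Red}_\tau,\ s\,t\in\mathrm{Red}_\sigma\}$; $\mathrm{Red}_{\Box\tau}=\{s:\forall u,\forall\mathcal C\in\mathrm{CR},\forall t\in\mathcal C^u_{\mathrm{Red}_\tau},\ \mathsf{let}(u^\tau:=s,t)\in\mathcal C\}$. -}

module Defs where

open import Data.Nat using (ℕ; zero; suc; _+_; _<ᵇ_; _≡ᵇ_)
open import Data.Nat.Base using (pred)
open import Data.Bool using (Bool; true; false; if_then_else_)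
open import Data.Fin using (Fin)
import Data.Fin as F
open import Data.Vec using (Vec; []; _∷_; lookup; _[_]≔_)
open import Data.Maybe using (Maybe; just; nothing)
open import Data.List using (List; []; _∷_)
import Data.List as L
open import Data.Product using (_×_; _,_; proj₁)
open import Data.List.Relation.Unary.Unique.Propositional using (Unique)
open import Level using (Lift; 0ℓ) renaming (suc to lsuc)
open import Data.Empty using (⊥)
open import Data.Unit using (⊤)
open import Relation.Binary.PropositionalEquality using (_≡_)

infixr 5 _⊃_
data Ty : Set where
  P   : ℕ → Ty
  _⊃_ : Ty → Ty → Ty
  □   : Ty → Ty

data Label : Set where
  Lrefl Ltrans Lβ Lβ□ Lti Llam Lapp Llet Ltrpl[] Ltrpl∷ Ld : Label

idx : Label → Fin 11
idx Lrefl   = F.# 0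
idx Ltrans  = F.# 1
idx Lβ      = F.# 2
idx Lβ□     = F.# 3
idx Lti     = F.# 4
idx Llam    = F.# 5
idx Lapp    = F.# 6
idx Llet    = F.# 7
idx Ltrpl[] = F.# 8
idx Ltrpl∷  = F.# 9
idx Ld      = F.# 10

-- Terms (de Bruijn; two disjoint index spaces: simple variables `svar`
-- bound by `lam`, audited variables `avar` bound by `let'` in its body).
-- A finite map θ from labels to terms is a table `Vec (Maybe Term) 11`
-- (nothing = label not in dom θ).

data Term : Set where
  svar : ℕ → Term
  avar : ℕ → Term
  lam  : Ty → Term → Term
  app  : Term → Term → Term
  bang : Term → Term
  let' : Ty → Term → Term → Term         -- let(u^τ := s, t)  (binds audited index 0 in t)
  TI   : Vec (Maybe Term) 11 → Term

LMap : Set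
LMap = Vec (Maybe Term) 11

_⟨_⟩ : LMap → Label → Maybe Term
θ ⟨ ψ ⟩ = lookup θ (idx ψ)

-- shift simple indices ≥ c by one (does not enter !)
shS  : ℕ → Term → Term
shSV : ∀ {n} → ℕ → Vec (Maybe Term) n → Vec (Maybe Term) n
shS c (svar i) = if i <ᵇ c then svar i else svar (suc i)
shS c (avar i) = avar i
shS c (lam τ s) = lam τ (shS (suc c) s)
shS c (app s t) = app (shS c s) (shS c t)
shS c (bang s) = bang s
shS c (let' τ s t) = let' τ (shS c s) (shS c t)
shS c (TI θ) = TI (shSV c θ)
shSV c [] = []
shSV c (nothing ∷ θ) = nothing ∷ shSV c θ
shSV c (just s ∷ θ) = just (shS c s) ∷ shSV c θ

shSn : ℕ → Term → Term
shSn zero s = s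
shSn (suc d) s = shS 0 (shSn d s)

shA  : ℕ → Term → Term
shAV : ∀ {n} → ℕ → Vec (Maybe Term) n → Vec (Maybe Term) n
shA c (svar i) = svar i
shA c (avar i) = if i <ᵇ c then avar i else avar (suc i)
shA c (lam τ s) = lam τ (shA c s)
shA c (app s t) = app (shA c s) (shA c t)
shA c (bang s) = bang (shA c s)
shA c (let' τ s t) = let' τ (shA c s) (shA (suc c) t)
shA c (TI θ) = TI (shAV c θ)
shAV c [] = []
shAV c (nothing ∷ θ) = nothing ∷ shAV c θ
shAV c (just s ∷ θ) = just (shA c s) ∷ shAV c θ

-- substS k r s : s[r/a_k], removing simple index k; does not enter !
substS  : ℕ → Term → Term → Term
substSV : ∀ {n} → ℕ → Term → Vec (Maybe Term) n → Vec (Maybe Term) n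
substS k r (svar i) =
  if i <ᵇ k then svar i else (if i ≡ᵇ k then r else svar (pred i))
substS k r (avar i) = avar i
substS k r (lam τ s) = lam τ (substS (suc k) (shS 0 r) s)
substS k r (app s t) = app (substS k r s) (substS k r t)
substS k r (bang s) = bang s
substS k r (let' τ s t) = let' τ (substS k r s) (substS k (shA 0 r) t)
substS k r (TI θ) = TI (substSV k r θ)
substSV k r [] = []
substSV k r (nothing ∷ θ) = nothing ∷ substSV k r θ
substSV k r (just s ∷ θ) = just (substS k r s) ∷ substSV k r θ

-- substA k d r s : s[r/u_k], removing audited index k; enters !.
-- r is kept relative to the top-level simple scope; d counts the λ's
-- passed since the last ! (simple indices of r are shifted by d).
substA  : ℕ → ℕ → Term → Term → Term
substAV : ∀ {n} → ℕ → ℕ → Term → Vec (Maybe Term) n → Vec (Maybe Term) n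
substA k d r (svar i) = svar i
substA k d r (avar i) =
  if i <ᵇ k then avar i else (if i ≡ᵇ k then shSn d r else avar (pred i))
substA k d r (lam τ s) = lam τ (substA k (suc d) r s)
substA k d r (app s t) = app (substA k d r s) (substA k d r t)
substA k d r (bang s) = bang (substA k 0 r s)
substA k d r (let' τ s t) = let' τ (substA k d r s) (substA (suc k) d (shA 0 r) t)
substA k d r (TI θ) = TI (substAV k d r θ)
substAV k d r [] = []
substAV k d r (nothing ∷ θ) = nothing ∷ substAV k d r θ
substAV k d r (just s ∷ θ) = just (substA k d r s) ∷ substAV k d r θ

_[_/a] : Term → Term → Term
s [ t /a] = substS 0 t s

_[_/u] : Term → Term → Term
s [ t /u] = substA 0 0 t s

data Trail : Set where
  refl  : Term → Trail
  trans : Trail → Trail → Trail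
  β     : Ty → Term → Term → Trail
  β□    : Term → Ty → Term → Trail
  ti    : Trail → LMap → Trail
  lam   : Ty → Trail → Trail
  app   : Trail → Trail → Trail
  let'  : Trail → Ty → Trail → Trail
  trpl  : (ζ : List (Label × Trail)) → Unique (L.map proj₁ ζ) → Trail

hd : Trail → Label
hd (refl _) = Lrefl
hd (trans _ _) = Ltrans
hd (β _ _ _) = Lβ
hd (β□ _ _ _) = Lβ□
hd (ti _ _) = Lti
hd (lam _ _) = Llam
hd (app _ _) = Lapp
hd (let' _ _ _) = Llet
hd (trpl [] _) = Ltrpl[]
hd (trpl (_ ∷ _) _) = Ltrpl∷

app₂ : Maybe Term → Maybe Term → Maybe Term → Maybe Term
app₂ (just f) (just x) (just y) = just (app (app f x) y)
app₂ _ _ _ = nothing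

app₁ : Maybe Term → Maybe Term → Maybe Term
app₁ (just f) (just x) = just (app f x)
app₁ _ _ = nothing

mutual
  eval : Trail → LMap → Maybe Term
  eval q θ with θ ⟨ hd q ⟩
  ... | nothing = θ ⟨ Ld ⟩
  ... | just f  = evalBody q θ

  evalBody : Trail → LMap → Maybe Term
  evalBody (refl _) θ = θ ⟨ Lrefl ⟩
  evalBody (trans q₁ q₂) θ = app₂ (θ ⟨ Ltrans ⟩) (eval q₁ θ) (eval q₂ θ)
  evalBody (β _ _ _) θ = θ ⟨ Lβ ⟩
  evalBody (β□ _ _ _) θ = θ ⟨ Lβ□ ⟩
  evalBody (ti _ _) θ = θ ⟨ Lti ⟩
  evalBody (lam _ q₁) θ = app₁ (θ ⟨ Llam ⟩) (eval q₁ θ)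
  evalBody (app q₁ q₂) θ = app₂ (θ ⟨ Lapp ⟩) (eval q₁ θ) (eval q₂ θ)
  evalBody (let' q₁ _ q₂) θ = app₂ (θ ⟨ Llet ⟩) (eval q₁ θ) (eval q₂ θ)
  evalBody (trpl ζ _) θ = evalZ ζ θ

  evalZ : List (Label × Trail) → LMap → Maybe Term
  evalZ [] θ with θ ⟨ Ltrpl[] ⟩
  ... | nothing = θ ⟨ Ld ⟩
  ... | just f  = just f
  evalZ ((ψ , q₁) ∷ ζ) θ with θ ⟨ Ltrpl∷ ⟩
  ... | nothing = θ ⟨ Ld ⟩
  ... | just f  = app₂ (just f) (eval q₁ θ) (evalZ ζ θ)

infix 4 _⟶_
data _⟶_ : Term → Term → Set where
  β-red  : ∀ {τ s t} → app (lam τ s) t ⟶ s [ t /a]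
  β□-red : ∀ {τ s t} → let' τ (bang s) t ⟶ t [ s /u]
  ti-red : ∀ {θ} (q : Trail) {r} → eval q θ ≡ just r → TI θ ⟶ r
  ξ-lam  : ∀ {τ s s'} → s ⟶ s' → lam τ s ⟶ lam τ s'
  ξ-appˡ : ∀ {s s' t} → s ⟶ s' → app s t ⟶ app s' t
  ξ-appʳ : ∀ {s t t'} → t ⟶ t' → app s t ⟶ app s t'
  ξ-bang : ∀ {s s'} → s ⟶ s' → bang s ⟶ bang s'
  ξ-letˡ : ∀ {τ s s' t} → s ⟶ s' → let' τ s t ⟶ let' τ s' t
  ξ-letʳ : ∀ {τ s t t'} → t ⟶ t' → let' τ s t ⟶ let' τ s t'
  ξ-TI   : ∀ {θ} (ψ : Label) {s s'} → θ ⟨ ψ ⟩ ≡ just s → s ⟶ s' →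
           TI θ ⟶ TI (θ [ idx ψ ]≔ just s')

data SN (s : Term) : Set where
  sn : (∀ t → s ⟶ t → SN t) → SN s

Neutral : Term → Set
Neutral (lam _ _) = ⊥
Neutral (bang _)  = ⊥
Neutral _         = ⊤

record CR (C : Term → Set) : Set where
  field
    CR1 : ∀ s → C s → SN s
    CR2 : ∀ s t → C s → s ⟶ t → C t
    CR3 : ∀ s → Neutral s → (∀ t → s ⟶ t → C t) → C s

Red : Ty → Term → Set₁
Red (P _)   s = Lift (lsuc 0ℓ) (SN s)
Red (τ ⊃ σ) s = ∀ t → Red τ t → Red σ (app s t)
Red (□ τ)   s =
  ∀ (C : Term → Set) → CR C →
  ∀ t → (C t × (∀ r → Red τ r → C (t [ r /u]))) →
  C (let' τ s t)

𝒯 : Ty → Label → Ty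
𝒯 σ Ld      = σ
𝒯 σ Lrefl   = σ
𝒯 σ Lβ      = σ
𝒯 σ Lβ□     = σ
𝒯 σ Lti     = σ
𝒯 σ Ltrpl[] = σ
𝒯 σ Llam    = σ ⊃ σ
𝒯 σ Ltrans  = σ ⊃ σ ⊃ σ
𝒯 σ Lapp    = σ ⊃ σ ⊃ σ
𝒯 σ Llet    = σ ⊃ σ ⊃ σ
𝒯 σ Ltrpl∷  = σ ⊃ σ ⊃ σ

-- Red σ is a reducibility candidate for every σ, so by CR3 it suffices that every one-step
-- reduct of the neutral term TI(θ) is reducible.  A reduct q θ is assembled by application
-- from the entries of θ, each reducible at the type 𝒯^σ(ψ) of its label, so it lies in Red σ.
-- A reduct obtained by reducing one entry of θ satisfies the hypothesis again, and since all
-- entries are strongly normalising this inner step can only be repeated finitely often.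
module Submission where

open import Defs
open import Data.Empty using (⊥-elim)
open import Data.Fin using (Fin; zero; suc; _≟_)
open import Data.Fin.Properties using (all?)
open import Data.List using ([]; _∷_)
open import Data.Maybe using (Maybe; just; nothing)
open import Data.Maybe.Relation.Unary.All using (All; just; nothing)
import Data.Maybe.Relation.Unary.All as MaybeAll
open import Data.Product using (_,_)
open import Data.Unit using (tt)
open import Data.Vec using (Vec; lookup; _[_]≔_)
import Data.Vec as Vec
open import Data.Vec.Properties using (lookup∘update; lookup∘update′)
import Data.Vec.Relation.Unary.All as VecAll
open import Data.Vec.Relation.Unary.All.Properties using (lookup⁻)
open import Function using (flip)
open import Induction.WellFounded using (Acc; acc)
open import Level using (lift; lower)
open import Relation.Binary.PropositionalEquality using (_≡_; refl; sym; cong; subst; module ≡-Reasoning)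
open import Relation.Nullary using (yes; no)
open import Relation.Nullary.Decidable using (toWitness)

All-fromJust : ∀ {p} {P : Term → Set p} {m} → (∀ x → m ≡ just x → P x) → All P m
All-fromJust {m = just x}  h = just (h x refl)
All-fromJust {m = nothing} h = nothing

All-atJust : ∀ {p} {P : Term → Set p} {m x} → All P m → m ≡ just x → P x
All-atJust (just px) refl = px

SN-appˡ : ∀ {s t} → SN (app s t) → SN s
SN-appˡ (sn h) = sn λ s' st → SN-appˡ (h _ (ξ-appˡ st))

SN-letˡ : ∀ {τ s t} → SN (let' τ s t) → SN s
SN-letˡ (sn h) = sn λ s' st → SN-letˡ (h _ (ξ-letˡ st))

SN-CR : CR SN
SN-CR = record
  { CR1 = λ _ sns → sns
  ; CR2 = λ { _ _ (sn h) st → h _ st }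
  ; CR3 = λ _ _ → sn
  }

-- The reduct of let(u := s, t) that reduces t is covered by reducing the hypothesis along
-- with it, so no information about t[r/u] is needed.
let-neutral : ∀ {C} → CR C → ∀ {τ s t} → Neutral s → SN t →
              (∀ {s'} → s ⟶ s' → C (let' τ s' t)) → C (let' τ s t)
let-neutral {C} cC {τ} {s} n (sn g) h = CR.CR3 cC _ tt reducts
  where
  reducts : ∀ r → let' τ s _ ⟶ r → C r
  reducts _ β□-red       = ⊥-elim n
  reducts _ (ξ-letˡ st) = h st
  reducts _ (ξ-letʳ st) = let-neutral cC n (g _ st) λ st' → CR.CR2 cC _ _ (h st') (ξ-letʳ st)

Red-⟶ : ∀ σ {s t} → Red σ s → s ⟶ t → Red σ t
Red-⟶ (P _)   (lift (sn g)) st = lift (g _ st)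
Red-⟶ (τ ⊃ σ) rs st = λ t rt → Red-⟶ σ (rs t rt) (ξ-appˡ st)
Red-⟶ (□ τ)   rs st = λ C cC t ht → CR.CR2 cC _ _ (rs C cC t ht) (ξ-letˡ st)

mutual
  Red-SN : ∀ σ {s} → Red σ s → SN s
  Red-SN (P _)   rs = lower rs
  Red-SN (τ ⊃ σ) rs = SN-appˡ (Red-SN σ (rs (svar 0) (Red-svar τ 0)))
  Red-SN (□ τ)   rs = SN-letˡ (rs SN SN-CR (avar 0) (sn (λ _ ()) , λ r → Red-SN τ))

  Red-neutral : ∀ σ {s} → Neutral s → (∀ t → s ⟶ t → Red σ t) → Red σ s
  Red-neutral (P _)   n h = lift (sn λ t st → lower (h t st))
  Red-neutral (τ ⊃ σ) n h = λ t rt →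
    Red-app-neutral τ σ n (Red-SN τ rt) rt λ st → h _ st t rt
  Red-neutral (□ τ)   n h = λ C cC t ht@(Ct , _) →
    let-neutral cC n (CR.CR1 cC t Ct) λ st → h _ st C cC t ht

  Red-app-neutral : ∀ τ σ {s t} → Neutral s → SN t → Red τ t →
                    (∀ {s'} → s ⟶ s' → Red σ (app s' t)) → Red σ (app s t)
  Red-app-neutral τ σ {s} n (sn g) rt h = Red-neutral σ tt reducts
    where
    reducts : ∀ r → app s _ ⟶ r → Red σ r
    reducts _ β-red       = ⊥-elim n
    reducts _ (ξ-appˡ st) = h st
    reducts _ (ξ-appʳ st) =
      Red-app-neutral τ σ n (g _ st) (Red-⟶ τ rt st) λ st' → Red-⟶ σ (h st') (ξ-appʳ st)

  Red-svar : ∀ τ i → Red τ (svar i)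
  Red-svar τ i = Red-neutral τ tt λ _ ()

RedTable : Ty → LMap → Set₁
RedTable σ θ = ∀ ψ → All (Red (𝒯 σ ψ)) (θ ⟨ ψ ⟩)

module _ {σ : Ty} {θ : LMap} (θ-red : RedTable σ θ) where

  app₁-Red : ∀ {f x} → All (Red (σ ⊃ σ)) f → All (Red σ) x → All (Red σ) (app₁ f x)
  app₁-Red (just rf) (just rx) = just (rf _ rx)
  app₁-Red (just _)  nothing   = nothing
  app₁-Red nothing   _         = nothing

  app₂-Red : ∀ {f x y} → All (Red (σ ⊃ σ ⊃ σ)) f → All (Red σ) x → All (Red σ) y →
             All (Red σ) (app₂ f x y)
  app₂-Red (just rf) (just rx) (just ry) = just (rf _ rx _ ry)
  app₂-Red (just _)  (just _)  nothing   = nothing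
  app₂-Red (just _)  nothing   _         = nothing
  app₂-Red nothing   _         _         = nothing

  mutual
    eval-Red : ∀ q → All (Red σ) (eval q θ)
    eval-Red q with θ ⟨ hd q ⟩
    ... | nothing = θ-red Ld
    ... | just _  = evalBody-Red q

    evalBody-Red : ∀ q → All (Red σ) (evalBody q θ)
    evalBody-Red (refl _)       = θ-red Lrefl
    evalBody-Red (trans q₁ q₂)  = app₂-Red (θ-red Ltrans) (eval-Red q₁) (eval-Red q₂)
    evalBody-Red (β _ _ _)      = θ-red Lβ
    evalBody-Red (β□ _ _ _)     = θ-red Lβ□
    evalBody-Red (ti _ _)       = θ-red Lti
    evalBody-Red (lam _ q₁)     = app₁-Red (θ-red Llam) (eval-Red q₁)
    evalBody-Red (app q₁ q₂)    = app₂-Red (θ-red Lapp) (eval-Red q₁) (eval-Red q₂)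
    evalBody-Red (let' q₁ _ q₂) = app₂-Red (θ-red Llet) (eval-Red q₁) (eval-Red q₂)
    evalBody-Red (trpl ζ _)     = evalZ-Red ζ

    evalZ-Red : ∀ ζ → All (Red σ) (evalZ ζ θ)
    evalZ-Red [] with θ ⟨ Ltrpl[] ⟩ | θ-red Ltrpl[]
    ... | nothing | _  = θ-red Ld
    ... | just _  | rf = rf
    evalZ-Red ((_ , q₁) ∷ ζ) with θ ⟨ Ltrpl∷ ⟩ | θ-red Ltrpl∷
    ... | nothing | _  = θ-red Ld
    ... | just _  | rf = app₂-Red rf (eval-Red q₁) (evalZ-Red ζ)

-- One-step reduction inside a table of optional terms; ξ-TI is exactly this step under TI.
data _⟶ᵗ_ {n} : Vec (Maybe Term) n → Vec (Maybe Term) n → Set where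
  entry : ∀ {θ} i {s s'} → lookup θ i ≡ just s → s ⟶ s' → θ ⟶ᵗ (θ [ i ]≔ just s')

SNᵗ : ∀ {n} → Vec (Maybe Term) n → Set
SNᵗ = Acc (flip _⟶ᵗ_)

SNᵗ-nothing∷ : ∀ {n} {θ : Vec (Maybe Term) n} → SNᵗ θ → SNᵗ (nothing Vec.∷ θ)
SNᵗ-nothing∷ (acc rs) = acc reduct
  where
  reduct : ∀ {θ'} → (nothing Vec.∷ _) ⟶ᵗ θ' → SNᵗ θ'
  reduct (entry zero () _)
  reduct (entry (suc i) e st) = SNᵗ-nothing∷ (rs (entry i e st))

SNᵗ-just∷ : ∀ {n s} {θ : Vec (Maybe Term) n} → SN s → SNᵗ θ → SNᵗ (just s Vec.∷ θ)
SNᵗ-just∷ (sn g) sθ@(acc rs) = acc reduct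
  where
  reduct : ∀ {θ'} → (just _ Vec.∷ _) ⟶ᵗ θ' → SNᵗ θ'
  reduct (entry zero refl st)   = SNᵗ-just∷ (g _ st) sθ
  reduct (entry (suc i) e st) = SNᵗ-just∷ (sn g) (rs (entry i e st))

SNᵗ-∷ : ∀ {n m} {θ : Vec (Maybe Term) n} → All SN m → SNᵗ θ → SNᵗ (m Vec.∷ θ)
SNᵗ-∷ nothing    = SNᵗ-nothing∷
SNᵗ-∷ (just sns) = SNᵗ-just∷ sns

SNᵗ-intro : ∀ {n} {θ : Vec (Maybe Term) n} → VecAll.All (All SN) θ → SNᵗ θ
SNᵗ-intro VecAll.[]       = acc λ { (entry () _ _) }
SNᵗ-intro (sm VecAll.∷ sθ) = SNᵗ-∷ sm (SNᵗ-intro sθ)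

label : Fin 11 → Label
label i = lookup (Lrefl Vec.∷ Ltrans Vec.∷ Lβ Vec.∷ Lβ□ Vec.∷ Lti Vec.∷ Llam Vec.∷ Lapp Vec.∷ Llet
          Vec.∷ Ltrpl[] Vec.∷ Ltrpl∷ Vec.∷ Ld Vec.∷ Vec.[]) i

idx-label : ∀ i → idx (label i) ≡ i
idx-label = toWitness {a? = all? λ i → idx (label i) ≟ i} tt

label-idx : ∀ ψ → label (idx ψ) ≡ ψ
label-idx Lrefl   = refl
label-idx Ltrans  = refl
label-idx Lβ      = refl
label-idx Lβ□     = refl
label-idx Lti     = refl
label-idx Llam    = refl
label-idx Lapp    = refl
label-idx Llet    = refl
label-idx Ltrpl[] = refl
label-idx Ltrpl∷  = refl
label-idx Ld      = refl

idx-injective : ∀ {ψ ψ'} → idx ψ ≡ idx ψ' → ψ ≡ ψ'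
idx-injective {ψ} {ψ'} e = begin
  ψ              ≡⟨ sym (label-idx ψ) ⟩
  label (idx ψ)  ≡⟨ cong label e ⟩
  label (idx ψ') ≡⟨ label-idx ψ' ⟩
  ψ'             ∎
  where open ≡-Reasoning

RedTable-SN : ∀ {σ θ} → RedTable σ θ → VecAll.All (All SN) θ
RedTable-SN {σ} {θ} θ-red = lookup⁻ λ i →
  subst (λ j → All SN (lookup θ j)) (idx-label i) (MaybeAll.map (Red-SN _) (θ-red (label i)))

RedTable-⟶ : ∀ {σ θ ψ s s'} → RedTable σ θ → θ ⟨ ψ ⟩ ≡ just s → s ⟶ s' →
             RedTable σ (θ [ idx ψ ]≔ just s')
RedTable-⟶ {σ} {θ} {ψ} {s' = s'} θ-red e st ψ' with idx ψ' ≟ idx ψ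
... | no i'≢i = subst (All _) (sym (lookup∘update′ i'≢i θ (just s'))) (θ-red ψ')
... | yes i'≡i with refl ← idx-injective {ψ'} {ψ} i'≡i =
  subst (All _) (sym (lookup∘update (idx ψ) θ (just s')))
        (just (Red-⟶ (𝒯 σ ψ) (All-atJust (θ-red ψ) e) st))

TI-Red : ∀ σ {θ} → SNᵗ θ → RedTable σ θ → Red σ (TI θ)
TI-Red σ {θ} (acc rs) θ-red = Red-neutral σ tt reduct
  where
  reduct : ∀ t → TI θ ⟶ t → Red σ t
  reduct _ (ti-red q e)  = All-atJust (eval-Red {θ = θ} θ-red q) e
  reduct _ (ξ-TI ψ e st) =
    TI-Red σ (rs (entry (idx ψ) e st)) (RedTable-⟶ {θ = θ} {ψ} θ-red e st)

mainTheorem14 : (σ : Ty) (θ : LMap) →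
    (∀ (ψ : Label) (s : Term) → θ ⟨ ψ ⟩ ≡ just s → Red (𝒯 σ ψ) s) →
    Red σ (TI θ)
mainTheorem14 σ θ H = TI-Red σ (SNᵗ-intro (RedTable-SN θ-red)) θ-red
  where
  θ-red : RedTable σ θ
  θ-red ψ = All-fromJust (H ψ)
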